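{- For every connected graph $G=(V,E)$, $\mathtt{nd}(G^2)\le \mathtt{mw}(G)$, where $G^2$ is the second power of $G$.
   Context: All graphs are finite, simple and undirected. $N_G(v)$ is the set of neighbours of $v$ in $G$; $G[S]$ is the subgraph induced by $S$. The $k$-th power $G^k$ of $G$ has vertex set $V$ and an edge between distinct $u,v$ iff their distance in $G$ is at most $k$. A set $M\subseteq V$ is a module of $G$ if every pair $u,v\in M$ satisfies $N_G(u)\setminus M=N_G(v)\setminus M$. For an integer $\ell\ge 2$, $G$ has modular-width at most $\ell$ if (i) $|V|\le\ell$, or (ii) there is a partition $(V_1,\ldots,V_\ell)$ of $V$ such that each $V_i$ is a module of $G$ and $G[V_i]$ has modular-width at most $\ell$; $\mathtt{mw}(G)$ is the minimum such $\ell$. A graph $G$ has neighborhood diversity at most $\ell$ if there is a partition $(V_1,\ldots,V_\ell)$ of $V$ such that every pair of vertices $u,v$ in the same $V_i$ satisfies $N_G(u)\setminus\{v\}=N_G(v)\setminus\{u\}$; $\mathtt{nd}(G)$ is the minimum such $\ell$. -}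

module Defs where

open import Level using (0ℓ)
open import Data.Nat using (ℕ; zero; suc; _≤_)
open import Data.Fin using (Fin; _≟_)
open import Data.Fin.Subset using (Subset; _∈_; _∉_; ∣_∣)
open import Data.Bool using (Bool; _∧_)
open import Data.Vec using (lookup; tabulate)
open import Data.Product using (Σ; ∃; _×_)
open import Relation.Nullary using (¬_; Dec)
open import Relation.Nullary.Decidable using (⌊_⌋)
open import Relation.Binary.PropositionalEquality using (_≡_; _≢_)
open import Function.Bundles using (_⇔_)

record Graph (n : ℕ) : Set₁ where
  field
    E      : Fin n → Fin n → Set
    E?     : ∀ u v → Dec (E u v)
    sym    : ∀ {u v} → E u v → E v u
    irrefl : ∀ {u} → ¬ E u u
open Graph public

module _ {n : ℕ} (G : Graph n) where

  data Walk : Fin n → Fin n → ℕ → Set where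
    nil  : ∀ {u} → Walk u u zero
    cons : ∀ {u w v l} → E G u w → Walk w v l → Walk u v (suc l)

  Connected : Set
  Connected = ∀ u v → ∃ λ l → Walk u v l

  PowerAdj : ℕ → Fin n → Fin n → Set
  PowerAdj k u v = u ≢ v × (∃ λ l → l ≤ k × Walk u v l)

  -- M ⊆ S is a module of G[S]
  IsModuleIn : Subset n → Subset n → Set
  IsModuleIn S M = ∀ u v → u ∈ M → v ∈ M →
    ∀ w → w ∈ S → w ∉ M → (E G u w ⇔ E G v w)

  part : ∀ {ℓ} → Subset n → (Fin n → Fin ℓ) → Fin ℓ → Subset n
  part S p i = tabulate (λ v → lookup S v ∧ ⌊ p v ≟ i ⌋)

  -- G[S] has modular-width at most ℓ
  data MWAtMost (ℓ : ℕ) : Subset n → Set where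
    small : ∀ {S} → ∣ S ∣ ≤ ℓ → MWAtMost ℓ S
    split : ∀ {S} (p : Fin n → Fin ℓ) →
            (∀ i → IsModuleIn S (part S p i)) →
            (∀ i → MWAtMost ℓ (part S p i)) →
            MWAtMost ℓ S

  HasMWAtMost : ℕ → Set
  HasMWAtMost ℓ = MWAtMost ℓ (tabulate (λ _ → Bool.true))
    where import Data.Bool as Bool

NDAtMost : ∀ {n} → (Fin n → Fin n → Set) → ℕ → Set
NDAtMost {n} A ℓ = Σ (Fin n → Fin ℓ) λ p → ∀ u v → p u ≡ p v →
  ∀ w → w ≢ u → w ≢ v → (A u w ⇔ A v w)

{-# OPTIONS --safe #-}
-- Let p be the top-level partition of a modular decomposition of G of width ℓ.
-- If p has at least two nonempty classes, every class M is a proper module, and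
-- by connectivity some vertex z ∉ M is adjacent to a vertex of M, hence to all
-- of M.  Then any two u, v ∈ M have the same G²-neighbours outside {u, v}:
-- inside M via z, and outside M because M is a module of G.  So p itself
-- witnesses nd(G²) ≤ ℓ.  If p has a single class, recurse into it; if the
-- decomposition is trivial, n ≤ ℓ and the identity partition works.
module Submission where

open import Defs
open import Data.Nat using (ℕ; zero; suc; _≤_; s≤s; z≤n)
open import Data.Nat.Properties using (≤-refl; ≤-trans)
open import Data.Fin as Fin using (Fin; _≟_; inject≤)
open import Data.Fin.Properties using (any?; inject≤-injective)
open import Data.Fin.Subset using (Subset; _∈_; _∉_; ⊤; ∣_∣)
open import Data.Fin.Subset.Properties using (_∈?_; ∣⊤∣≡n; p⊆q⇒∣p∣≤∣q∣)
open import Data.Bool using (T; true)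
open import Data.Bool.Properties using (T-≡; T-∧)
open import Data.Vec using (lookup; tabulate)
open import Data.Vec.Properties using ([]=⇒lookup; lookup⇒[]=; lookup∘tabulate)
open import Data.Product using (∃; _×_; _,_; proj₂)
open import Data.Sum using (_⊎_; inj₁; inj₂)
open import Data.Empty using (⊥-elim)
open import Relation.Nullary using (yes; no; ¬?)
open import Relation.Nullary.Decidable using (fromWitness; toWitness; decidable-stable)
open import Relation.Binary.PropositionalEquality using (_≡_; _≢_; refl; trans; cong₂; subst)
  renaming (sym to ≡-sym)
open import Function.Bundles using (_⇔_; mk⇔; Equivalence)
open import Function.Base using (_∘_)

ndAtMost-of-≤ : ∀ {n ℓ} (A : Fin n → Fin n → Set) → n ≤ ℓ → NDAtMost A ℓ
ndAtMost-of-≤ A n≤ℓ = (λ u → inject≤ u n≤ℓ) , twins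
  where
  twins : ∀ u v → inject≤ u n≤ℓ ≡ inject≤ v n≤ℓ → ∀ w → w ≢ u → w ≢ v → A u w ⇔ A v w
  twins u v eq w _ _ with refl ← inject≤-injective n≤ℓ n≤ℓ u v eq = mk⇔ (λ a → a) (λ a → a)

ndAtMost-from-vertex : ∀ {n ℓ} {A : Fin n → Fin n → Set} →
                       (Fin n → NDAtMost A ℓ) → NDAtMost A ℓ
ndAtMost-from-vertex {zero}  f = (λ ()) , λ ()
ndAtMost-from-vertex {suc _} f = f Fin.zero

constant-or-separated : ∀ {n ℓ} (p : Fin n → Fin ℓ) →
                        (∀ a b → p a ≡ p b) ⊎ (∃ λ a → ∃ λ b → p a ≢ p b)
constant-or-separated p with any? (λ a → any? (λ b → ¬? (p a ≟ p b)))
... | yes (a , b , pa≢pb) = inj₂ (a , b , pa≢pb)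
... | no  none = inj₁ λ a b → decidable-stable (p a ≟ p b) (λ pa≢pb → none (a , b , pa≢pb))

∈⇔T-lookup : ∀ {n} {S : Subset n} {v} → v ∈ S ⇔ T (lookup S v)
∈⇔T-lookup = mk⇔ (Equivalence.from T-≡ ∘ []=⇒lookup) (lookup⇒[]= _ _ ∘ Equivalence.to T-≡)

Full : ∀ {n} → Subset n → Set
Full S = ∀ v → v ∈ S

full-size : ∀ {n} {S : Subset n} → Full S → n ≤ ∣ S ∣
full-size {n} {S} full = subst (_≤ ∣ S ∣) (∣⊤∣≡n n) (p⊆q⇒∣p∣≤∣q∣ {p = ⊤} (λ {v} _ → full v))

module _ {n : ℕ} (G : Graph n) where

  ∈-part⁺ : ∀ {ℓ} {S : Subset n} {p : Fin n → Fin ℓ} {i v} →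
            v ∈ S → p v ≡ i → v ∈ part G S p i
  ∈-part⁺ {S = S} {p} {i} {v} v∈S pv≡i = Equivalence.from ∈⇔T-lookup
    (subst T (≡-sym (lookup∘tabulate _ v))
      (Equivalence.from (T-∧ {lookup S v})
        (Equivalence.to ∈⇔T-lookup v∈S , fromWitness {a? = p v ≟ i} pv≡i)))

  ∈-part⁻ : ∀ {ℓ} {S : Subset n} {p : Fin n → Fin ℓ} {i v} →
            v ∈ part G S p i → p v ≡ i
  ∈-part⁻ {S = S} {v = v} v∈part = toWitness (proj₂ (Equivalence.to (T-∧ {lookup S v})
    (subst T (lookup∘tabulate _ v) (Equivalence.to ∈⇔T-lookup v∈part))))

  module-adj : ∀ {S M} → Full S → IsModuleIn G S M → ∀ {u v w} →
               u ∈ M → v ∈ M → w ∉ M → E G u w → E G v w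
  module-adj full mod u∈M v∈M w∉M = Equivalence.to (mod _ _ u∈M v∈M _ (full _) w∉M)

  walk-leaves : (M : Subset n) → ∀ {x t l} → Walk G x t l → x ∈ M → t ∉ M →
                ∃ λ y → ∃ λ z → y ∈ M × z ∉ M × E G y z
  walk-leaves M nil x∈M t∉M = ⊥-elim (t∉M x∈M)
  walk-leaves M {x} (cons {w = w} xw walk) x∈M t∉M with w ∈? M
  ... | yes w∈M = walk-leaves M walk w∈M t∉M
  ... | no  w∉M = x , w , x∈M , w∉M , xw

  proper-module-dominated : Connected G → ∀ {S M} → Full S → IsModuleIn G S M →
                            ∀ {u t} → u ∈ M → t ∉ M →
                            ∃ λ z → z ∉ M × (∀ m → m ∈ M → E G m z)
  proper-module-dominated conn full mod u∈M t∉M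
    with y , z , y∈M , z∉M , yz ← walk-leaves _ (proj₂ (conn _ _)) u∈M t∉M
    = z , z∉M , λ m m∈M → module-adj full mod y∈M m∈M z∉M yz

  module-short-walk : ∀ {S M} → Full S → IsModuleIn G S M → ∀ {u v w l} →
                      u ∈ M → v ∈ M → w ∉ M → l ≤ 2 → Walk G u w l →
                      ∃ λ l′ → l′ ≤ 2 × Walk G v w l′
  module-short-walk full mod u∈M v∈M w∉M _ nil = ⊥-elim (w∉M u∈M)
  module-short-walk full mod u∈M v∈M w∉M _ (cons uw nil) =
    1 , s≤s z≤n , cons (module-adj full mod u∈M v∈M w∉M uw) nil
  module-short-walk {M = M} full mod u∈M v∈M w∉M _ (cons {w = y} uy (cons yw nil)) with y ∈? M
  ... | yes y∈M = 1 , s≤s z≤n , cons (module-adj full mod y∈M v∈M w∉M yw) nil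
  ... | no  y∉M = 2 , ≤-refl , cons (module-adj full mod u∈M v∈M y∉M uy) (cons yw nil)
  module-short-walk full mod u∈M v∈M w∉M (s≤s (s≤s ())) (cons _ (cons _ (cons _ _)))

  dominated-module-power²-adj : ∀ {S M z} → Full S → IsModuleIn G S M →
                                (∀ m → m ∈ M → E G m z) → ∀ {u v w} →
                                u ∈ M → v ∈ M → w ≢ v → PowerAdj G 2 u w → PowerAdj G 2 v w
  dominated-module-power²-adj {M = M} full mod dom {v = v} {w} u∈M v∈M w≢v (_ , _ , l≤2 , walk)
    with w ∈? M
  ... | yes w∈M = w≢v ∘ ≡-sym , 2 , ≤-refl , cons (dom v v∈M) (cons (Graph.sym G (dom w w∈M)) nil)
  ... | no  w∉M = w≢v ∘ ≡-sym , module-short-walk full mod u∈M v∈M w∉M l≤2 walk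

  ndAtMost-power²-of-separated-split :
    Connected G → ∀ {ℓ S} {p : Fin n → Fin ℓ} → Full S →
    (∀ i → IsModuleIn G S (part G S p i)) → ∀ {a b} → p a ≢ p b →
    NDAtMost (PowerAdj G 2) ℓ
  ndAtMost-power²-of-separated-split conn {S = S} {p} full mods {a} {b} pa≢pb = p , twins
    where
    outside-class : ∀ i → ∃ λ t → t ∉ part G S p i
    outside-class i with p a ≟ i
    ... | yes pa≡i = b , λ b∈ → pa≢pb (trans pa≡i (≡-sym (∈-part⁻ {S = S} {p} b∈)))
    ... | no  pa≢i = a , λ a∈ → pa≢i (∈-part⁻ {S = S} {p} a∈)

    twins : ∀ u v → p u ≡ p v → ∀ w → w ≢ u → w ≢ v →
            PowerAdj G 2 u w ⇔ PowerAdj G 2 v w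
    twins u v pu≡pv w w≢u w≢v =
      mk⇔ (dominated-module-power²-adj full mod dom u∈M v∈M w≢v)
          (dominated-module-power²-adj full mod dom v∈M u∈M w≢u)
      where
      mod = mods (p u)
      u∈M = ∈-part⁺ (full u) refl
      v∈M = ∈-part⁺ (full v) (≡-sym pu≡pv)
      dom = proj₂ (proj₂ (proper-module-dominated conn full mod u∈M (proj₂ (outside-class (p u)))))

  ndAtMost-power²-of-mw : Connected G → ∀ {ℓ S} → MWAtMost G ℓ S → Full S →
                          NDAtMost (PowerAdj G 2) ℓ
  ndAtMost-power²-of-mw conn (small ∣S∣≤ℓ) full =
    ndAtMost-of-≤ _ (≤-trans (full-size full) ∣S∣≤ℓ)
  ndAtMost-power²-of-mw conn (split p mods subs) full with constant-or-separated p
  ... | inj₂ (_ , _ , pa≢pb) = ndAtMost-power²-of-separated-split conn full mods pa≢pb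
  ... | inj₁ constant = ndAtMost-from-vertex λ a →
    ndAtMost-power²-of-mw conn (subs (p a)) (λ v → ∈-part⁺ (full v) (constant v a))

proposition2 : ∀ {n} (G : Graph n) → Connected G →
    ∀ (ℓ : ℕ) → 2 ≤ ℓ → HasMWAtMost G ℓ → NDAtMost (PowerAdj G 2) ℓ
proposition2 G conn ℓ _ mw = ndAtMost-power²-of-mw G conn mw all-vertices
  where
  all-vertices : Full (tabulate λ _ → true)
  all-vertices v = lookup⇒[]= v _ (lookup∘tabulate _ v)
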